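{- Let $a,b$ be integers with $1\leq a\leq b$, let $h\geq0$ be an integer, and let $Q_{a,b}^{(h)}=U^{a+h}D^aU^bD^{b+h}$. If $h>1$ or $b-a>1$, then $\mu(UD,Q_{a,b}^{(h)})=0$, where $\mu$ is the M\"obius function of the Dyck pattern poset.
   Context: A Dyck path is a word over $\{U,D\}$ with equally many $U$'s and $D$'s such that every prefix has at least as many $U$'s as $D$'s. The Dyck pattern poset is the set of nonempty Dyck paths ordered by $P\leq Q$ iff $P$ is a subword of $Q$ (obtained by deleting letters, not necessarily consecutive). $U^a$ denotes $a$ consecutive $U$'s. The M\"obius function is defined by $\mu(x,x)=1$ and $\mu(x,y)=-\sum_{x\leq z<y}\mu(x,z)$ for $x<y$. The paper assumes $a\leq b$. -}

module Defs where

open import Data.Bool using (Bool; true; false; _∧_; _∨_; not; if_then_else_)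
open import Data.Nat using (ℕ; zero; suc; _≡ᵇ_)
open import Data.Integer using (ℤ; -_; _+_) renaming (0ℤ to z0; 1ℤ to z1)
open import Data.List using (List; []; _∷_; _++_; map; length; filterᵇ; deduplicateᵇ; foldr; replicate)

data Step : Set where
  U D : Step

_==ˢ_ : Step → Step → Bool
U ==ˢ U = true
D ==ˢ D = true
_ ==ˢ _ = false

Word : Set
Word = List Step

_==ʷ_ : Word → Word → Bool
[] ==ʷ [] = true
(x ∷ xs) ==ʷ (y ∷ ys) = (x ==ˢ y) ∧ (xs ==ʷ ys)
_ ==ʷ _ = false

dyckFrom : ℕ → Word → Bool
dyckFrom h [] = h ≡ᵇ 0
dyckFrom h (U ∷ w) = dyckFrom (suc h) w
dyckFrom zero (D ∷ w) = false
dyckFrom (suc h) (D ∷ w) = dyckFrom h w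

isDyck : Word → Bool
isDyck [] = false
isDyck w@(_ ∷ _) = dyckFrom 0 w

_⊑ᵇ_ : Word → Word → Bool
[] ⊑ᵇ _ = true
(_ ∷ _) ⊑ᵇ [] = false
(x ∷ xs) ⊑ᵇ (y ∷ ys) = ((x ==ˢ y) ∧ (xs ⊑ᵇ ys)) ∨ ((x ∷ xs) ⊑ᵇ ys)

-- all subsequences (with repetitions)
subseqs : Word → List Word
subseqs [] = [] ∷ []
subseqs (x ∷ xs) = let r = subseqs xs in map (x ∷_) r ++ r

sumℤ : List ℤ → ℤ
sumℤ = foldr _+_ z0

halfOpen : Word → Word → List Word
halfOpen x y =
  deduplicateᵇ _==ʷ_
    (filterᵇ (λ z → isDyck z ∧ (x ⊑ᵇ z) ∧ not (z ==ʷ y)) (subseqs y))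

-- The fuel only bounds recursion depth: each
-- recursive call is on a proper subword z of y, so length z < length y.
μF : ℕ → Word → Word → ℤ
μF zero x y = if x ==ʷ y then z1 else z0
μF (suc n) x y =
  if x ==ʷ y then z1
  else if x ⊑ᵇ y then - sumℤ (map (μF n x) (halfOpen x y))
  else z0

μ : Word → Word → ℤ
μ x y = μF (length y) x y

Q : ℕ → ℕ → ℕ → Word
Q a b h = replicate (a Data.Nat.+ h) U ++ replicate a D ++ replicate b U ++ replicate (b Data.Nat.+ h) D

-- μ(UD, -) is pinned down on the interval below Q by its defining recursion, so it suffices to
-- exhibit a weighting of Dyck words that is 1 at UD and whose total weight below every other
-- Dyck subword z of Q vanishes.  Every such z is a peak UⁿDⁿ or a two-peak word
-- U^(p+q) D^p U^r D^(r+q) with p ≤ a, and two-peak words compare componentwise in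
-- (p + q, p, r, r + q).  The weighting used lives on UD, UUDD and the balanced two-peak words
-- (q ≤ 1, |p − r| ≤ 1); below a peak or a two-peak word with q ≥ 1 its weights cancel in pairs,
-- and below a two-peak word with q = 0 they telescope to an inclusion–exclusion identity.
-- Q is not balanced when h ≥ 2 or b − a ≥ 2, so its weight, μ(UD, Q), is 0.

module Submission where

open import Defs
open import Data.Bool using (Bool; T; true; false; _∧_; _∨_; not)
open import Data.Bool.Properties
  using (∨-zeroʳ; ∧-zeroʳ; ∨-assoc; ∧-distribˡ-∨; T-≡; ⇔→≡)
open import Data.Nat using (ℕ; zero; suc; _≤_; _<_; _∸_; _≤ᵇ_; z≤n; s≤s; z<s; sz<ss)
  renaming (_+_ to _+ℕ_)
open import Data.Nat.Properties
  using ( ≤-refl; ≤-trans; ≤-pred; ≤∧≢⇒<; <⇒≱; m≤n⇒m≤1+n; n≤1+n; m≤m+n; m≤n+m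
        ; ≤⇒≤ᵇ; ≤ᵇ⇒≤; +-suc; +-identityʳ; +-comm; m+[n∸m]≡n; m+n∸n≡m; +-mono-≤; +-monoˡ-≤; +-monoʳ-≤
        ; +-cancelˡ-≤; ∸-monoˡ-≤)
open import Data.Integer using (ℤ; 0ℤ; 1ℤ; -1ℤ; +_; -_; _+_; _*_; _-_)
import Data.Integer.Properties as ℤ
open import Data.Integer.Tactic.RingSolver using (solve-∀)
open import Data.List
  using (List; []; _∷_; _++_; map; length; filter; filterᵇ; deduplicateᵇ; replicate; head)
open import Data.List.Properties using (++-identityʳ; ++-assoc; ∷-injectiveʳ; length-replicate)
open import Data.List.Relation.Unary.All as All using (All; []; _∷_)
import Data.List.Relation.Unary.All.Properties as Allₚ
open import Data.List.Relation.Binary.Sublist.Propositional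
  using (_⊆_; []; _∷_; _∷ʳ_; minimum; ⊆-refl; ⊆-reflexive; ⊆-trans)
open import Data.List.Relation.Binary.Sublist.Propositional.Properties
  using (length-mono-≤; to-≋; ++⁺)
open import Data.List.Relation.Binary.Equality.Propositional using (≋⇒≡)
open import Data.Maybe using (just)
open import Data.Product using (_×_; _,_; proj₁; ∃-syntax)
open import Data.Sum using (_⊎_; [_,_])
open import Function using (_∘_; _∘₂_; flip; Equivalence; mk⇔)
open import Relation.Nullary using (¬_; does; contradiction)
open import Relation.Nullary.Decidable using (¬?; T?)
open import Relation.Unary using (Pred; Decidable)
open import Relation.Binary.PropositionalEquality
  using (_≡_; _≢_; refl; sym; trans; cong; cong₂; subst; subst₂; module ≡-Reasoning)

UD : Word
UD = U ∷ D ∷ []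

==ˢ-refl : ∀ x → (x ==ˢ x) ≡ true
==ˢ-refl U = refl
==ˢ-refl D = refl

==ˢ-sound : ∀ {x y} → (x ==ˢ y) ≡ true → x ≡ y
==ˢ-sound {U} {U} _ = refl
==ˢ-sound {D} {D} _ = refl

==ʷ-refl : ∀ w → (w ==ʷ w) ≡ true
==ʷ-refl [] = refl
==ʷ-refl (x ∷ w) rewrite ==ˢ-refl x = ==ʷ-refl w

==ʷ-sound : ∀ {v w} → (v ==ʷ w) ≡ true → v ≡ w
==ʷ-sound {[]} {[]} _ = refl
==ʷ-sound {x ∷ v} {y ∷ w} eq with x ==ˢ y in x=y
... | true = cong₂ _∷_ (==ˢ-sound x=y) (==ʷ-sound eq)

==ʷ-false : ∀ {v w} → v ≢ w → (v ==ʷ w) ≡ false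
==ʷ-false {v} {w} v≢w with v ==ʷ w in v=w
... | true = contradiction (==ʷ-sound v=w) v≢w
... | false = refl

==ʷ-false⇒≢ : ∀ {v w} → (v ==ʷ w) ≡ false → v ≢ w
==ʷ-false⇒≢ {v} eq refl = contradiction (trans (sym (==ʷ-refl v)) eq) λ ()

⊑ᵇ-complete : ∀ {xs ys} → xs ⊆ ys → (xs ⊑ᵇ ys) ≡ true
⊑ᵇ-complete [] = refl
⊑ᵇ-complete {[]} (_ ∷ʳ _) = refl
⊑ᵇ-complete {_ ∷ _} (_ ∷ʳ p) rewrite ⊑ᵇ-complete p = ∨-zeroʳ _
⊑ᵇ-complete {x ∷ _} (refl ∷ p) rewrite ==ˢ-refl x | ⊑ᵇ-complete p = refl

⊑ᵇ-sound : ∀ {xs ys} → (xs ⊑ᵇ ys) ≡ true → xs ⊆ ys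
⊑ᵇ-sound {[]} _ = minimum _
⊑ᵇ-sound {x ∷ xs} {y ∷ ys} eq
  with x ==ˢ y in x=y | xs ⊑ᵇ ys in xs⊑ys | (x ∷ xs) ⊑ᵇ ys in x∷xs⊑ys
... | true | true | _ = ==ˢ-sound x=y ∷ ⊑ᵇ-sound xs⊑ys
... | true | false | true = y ∷ʳ ⊑ᵇ-sound x∷xs⊑ys
... | false | _ | true = y ∷ʳ ⊑ᵇ-sound x∷xs⊑ys

⊑ᵇ-false : ∀ {xs ys} → ¬ xs ⊆ ys → (xs ⊑ᵇ ys) ≡ false
⊑ᵇ-false {xs} {ys} xs⊈ys with xs ⊑ᵇ ys in xs⊑ys
... | true = contradiction (⊑ᵇ-sound xs⊑ys) xs⊈ys
... | false = refl

≤ᵇ-true : ∀ {m n} → m ≤ n → (m ≤ᵇ n) ≡ true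
≤ᵇ-true m≤n = Equivalence.to T-≡ (≤⇒≤ᵇ m≤n)

≤ᵇ-true⁻ : ∀ {m n} → (m ≤ᵇ n) ≡ true → m ≤ n
≤ᵇ-true⁻ {m} {n} eq = ≤ᵇ⇒≤ m n (Equivalence.from T-≡ eq)

≤ᵇ-false : ∀ {m n} → n < m → (m ≤ᵇ n) ≡ false
≤ᵇ-false {m} {n} n<m with m ≤ᵇ n in m≤n
... | true = contradiction (≤ᵇ-true⁻ m≤n) (<⇒≱ n<m)
... | false = refl

∧-true⁻ : ∀ {a b} → a ∧ b ≡ true → a ≡ true × b ≡ true
∧-true⁻ {true} {true} _ = refl , refl

𝟙 : Bool → ℤ
𝟙 true = 1ℤ
𝟙 false = 0ℤ

_∈ᵇ_ : Word → List Word → Bool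
t ∈ᵇ [] = false
t ∈ᵇ (w ∷ L) = (t ==ʷ w) ∨ (t ∈ᵇ L)

count : Word → List Word → ℤ
count t L = sumℤ (map (𝟙 ∘ (t ==ʷ_)) L)

module _ {ℓ} {P : Pred Word ℓ} (P? : Decidable P) where

  count-filter-kept : ∀ {t} → does (P? t) ≡ true → ∀ L → count t (filter P? L) ≡ count t L
  count-filter-kept _ [] = refl
  count-filter-kept {t} Pt (w ∷ L) with t ==ʷ w in t=w
  ... | true with ==ʷ-sound {t} {w} t=w
  ...   | refl rewrite Pt | ==ʷ-refl t = cong (_+_ 1ℤ) (count-filter-kept Pt L)
  count-filter-kept {t} Pt (w ∷ L) | false with does (P? w)
  ...   | true rewrite t=w = cong (_+_ 0ℤ) (count-filter-kept Pt L)
  ...   | false = trans (count-filter-kept Pt L) (sym (ℤ.+-identityˡ _))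

  count-filter-dropped : ∀ {t} → does (P? t) ≡ false → ∀ L → count t (filter P? L) ≡ 0ℤ
  count-filter-dropped _ [] = refl
  count-filter-dropped {t} Pt (w ∷ L) with t ==ʷ w in t=w
  ... | true with ==ʷ-sound {t} {w} t=w
  ...   | refl rewrite Pt = count-filter-dropped Pt L
  count-filter-dropped {t} Pt (w ∷ L) | false with does (P? w)
  ...   | true rewrite t=w = trans (ℤ.+-identityˡ _) (count-filter-dropped Pt L)
  ...   | false = count-filter-dropped Pt L

count-deduplicate : ∀ t L → count t (deduplicateᵇ _==ʷ_ L) ≡ 𝟙 (t ∈ᵇ L)
count-deduplicate t [] = refl
count-deduplicate t (w ∷ L) with t ==ʷ w in t=w
... | true with ==ʷ-sound {t} {w} t=w
...   | refl = cong (_+_ 1ℤ)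
  (count-filter-dropped (λ y → ¬? (T? (t ==ʷ y))) {t} (cong not (==ʷ-refl t)) (deduplicateᵇ _==ʷ_ L))
count-deduplicate t (w ∷ L) | false = trans (ℤ.+-identityˡ _) (trans kept (count-deduplicate t L))
  where
  w≠t : not (w ==ʷ t) ≡ true
  w≠t = cong not (==ʷ-false {w} {t} (==ʷ-false⇒≢ {t} {w} t=w ∘ sym))
  rest : List Word
  rest = deduplicateᵇ _==ʷ_ L
  kept : count t (filter (λ y → ¬? (T? (w ==ʷ y))) rest) ≡ count t rest
  kept = count-filter-kept (λ y → ¬? (T? (w ==ʷ y))) w≠t rest

∈ᵇ-filterᵇ : ∀ t p L → t ∈ᵇ filterᵇ p L ≡ p t ∧ (t ∈ᵇ L)
∈ᵇ-filterᵇ t p [] = sym (∧-zeroʳ (p t))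
∈ᵇ-filterᵇ t p (w ∷ L) with t ==ʷ w in t=w
... | true with ==ʷ-sound {t} {w} t=w
...   | refl with p t in pt
...     | true rewrite ==ʷ-refl t = refl
...     | false = trans (∈ᵇ-filterᵇ t p L) (cong (_∧ (t ∈ᵇ L)) pt)
∈ᵇ-filterᵇ t p (w ∷ L) | false with p w
... | true rewrite t=w = ∈ᵇ-filterᵇ t p L
... | false = ∈ᵇ-filterᵇ t p L

∈ᵇ-++ : ∀ t A B → t ∈ᵇ (A ++ B) ≡ (t ∈ᵇ A) ∨ (t ∈ᵇ B)
∈ᵇ-++ t [] B = refl
∈ᵇ-++ t (w ∷ A) B rewrite ∈ᵇ-++ t A B = sym (∨-assoc (t ==ʷ w) _ _)

[]∉ᵇmap-∷ : ∀ x L → [] ∈ᵇ map (x ∷_) L ≡ false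
[]∉ᵇmap-∷ x [] = refl
[]∉ᵇmap-∷ x (w ∷ L) = []∉ᵇmap-∷ x L

∷∈ᵇmap-∷ : ∀ y u x L → (y ∷ u) ∈ᵇ map (x ∷_) L ≡ (y ==ˢ x) ∧ (u ∈ᵇ L)
∷∈ᵇmap-∷ y u x [] = sym (∧-zeroʳ _)
∷∈ᵇmap-∷ y u x (w ∷ L) rewrite ∷∈ᵇmap-∷ y u x L =
  sym (∧-distribˡ-∨ (y ==ˢ x) (u ==ʷ w) (u ∈ᵇ L))

∈ᵇ-subseqs : ∀ t y → t ∈ᵇ subseqs y ≡ t ⊑ᵇ y
∈ᵇ-subseqs [] [] = refl
∈ᵇ-subseqs (_ ∷ _) [] = refl
∈ᵇ-subseqs [] (x ∷ y)
  rewrite ∈ᵇ-++ [] (map (x ∷_) (subseqs y)) (subseqs y)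
        | []∉ᵇmap-∷ x (subseqs y) = ∈ᵇ-subseqs [] y
∈ᵇ-subseqs (t₀ ∷ t) (x ∷ y)
  rewrite ∈ᵇ-++ (t₀ ∷ t) (map (x ∷_) (subseqs y)) (subseqs y)
        | ∷∈ᵇmap-∷ t₀ t x (subseqs y) | ∈ᵇ-subseqs t y | ∈ᵇ-subseqs (t₀ ∷ t) y = refl

halfOpenFilter : Word → Word → Word → Bool
halfOpenFilter x y z = isDyck z ∧ (x ⊑ᵇ z) ∧ not (z ==ʷ y)

count-halfOpen : ∀ x y {s} → isDyck s ≡ true → (x ⊑ᵇ s) ≡ true →
                 count s (halfOpen x y) ≡ 𝟙 (s ⊑ᵇ y) - 𝟙 (s ==ʷ y)
count-halfOpen x y {s} dyck x⊑s
  rewrite count-deduplicate s (filterᵇ (halfOpenFilter x y) (subseqs y))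
        | ∈ᵇ-filterᵇ s (halfOpenFilter x y) (subseqs y)
        | ∈ᵇ-subseqs s y | dyck | x⊑s
        with s ==ʷ y in s=y
... | true rewrite ==ʷ-sound {s} {y} s=y | ⊑ᵇ-complete (⊆-refl {x = y}) = refl
... | false with s ⊑ᵇ y
...   | true = refl
...   | false = refl

subseqs-⊆ : ∀ y → All (_⊆ y) (subseqs y)
subseqs-⊆ [] = [] ∷ []
subseqs-⊆ (x ∷ y) =
  Allₚ.++⁺ (Allₚ.map⁺ (All.map (refl ∷_) (subseqs-⊆ y))) (All.map (x ∷ʳ_) (subseqs-⊆ y))

halfOpen-below : ∀ x y → All (λ z → z ⊆ y × isDyck z ≡ true × z ≢ y) (halfOpen x y)
halfOpen-below x y = Allₚ.deduplicate⁺ (T? ∘₂ _==ʷ_)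
  (All.zipWith filtered (Allₚ.filter⁺ P? (subseqs-⊆ y) , Allₚ.all-filter P? (subseqs y)))
  where
  P? : Decidable (T ∘ halfOpenFilter x y)
  P? = T? ∘ halfOpenFilter x y
  filtered : ∀ {z} → z ⊆ y × T (halfOpenFilter x y z) → z ⊆ y × isDyck z ≡ true × z ≢ y
  filtered {z} (z⊆y , ok) with isDyck z | x ⊑ᵇ z | z ==ʷ y in z=y
  ... | true | true | false = z⊆y , refl , ==ʷ-false⇒≢ z=y

⊂⇒length< : ∀ {v w : Word} → v ⊆ w → v ≢ w → length v < length w
⊂⇒length< v⊆w v≢w =
  ≤∧≢⇒< (length-mono-≤ v⊆w) (λ same-length → v≢w (≋⇒≡ (to-≋ same-length v⊆w)))

-- Weightings of words and the Möbius recursion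

Weighted : Set
Weighted = List (Word × ℤ)

OnSupport : (Word → Set) → Weighted → Set
OnSupport P = All (P ∘ proj₁)

weigh : (Word → ℤ) → Weighted → ℤ
weigh f [] = 0ℤ
weigh f ((s , v) ∷ S) = v * f s + weigh f S

mass : (Word → Bool) → Weighted → ℤ
mass p = weigh (𝟙 ∘ p)

coeff : Weighted → Word → ℤ
coeff S z = mass (_==ʷ z) S

weigh-++ : ∀ f S T → weigh f (S ++ T) ≡ weigh f S + weigh f T
weigh-++ f [] T = sym (ℤ.+-identityˡ _)
weigh-++ f ((s , v) ∷ S) T rewrite weigh-++ f S T = sym (ℤ.+-assoc (v * f s) _ _)

weigh-cong : ∀ {f g S} → OnSupport (λ s → f s ≡ g s) S → weigh f S ≡ weigh g S
weigh-cong [] = refl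
weigh-cong {S = (_ , v) ∷ _} (eq ∷ eqs) = cong₂ _+_ (cong (v *_) eq) (weigh-cong eqs)

weigh-zero : ∀ {f S} → OnSupport (λ s → f s ≡ 0ℤ) S → weigh f S ≡ 0ℤ
weigh-zero [] = refl
weigh-zero {S = (_ , v) ∷ _} (eq ∷ eqs) rewrite eq | weigh-zero eqs | ℤ.*-zeroʳ v = refl

weigh-+ : ∀ f g S → weigh (λ s → f s + g s) S ≡ weigh f S + weigh g S
weigh-+ f g [] = refl
weigh-+ f g ((s , v) ∷ S) rewrite weigh-+ f g S = lemma v (f s) (g s) (weigh f S) (weigh g S)
  where
  lemma : ∀ v a b A B → v * (a + b) + (A + B) ≡ (v * a + A) + (v * b + B)
  lemma = solve-∀

weigh-- : ∀ f g S → weigh (λ s → f s - g s) S ≡ weigh f S - weigh g S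
weigh-- f g [] = refl
weigh-- f g ((s , v) ∷ S) rewrite weigh-- f g S = lemma v (f s) (g s) (weigh f S) (weigh g S)
  where
  lemma : ∀ v a b A B → v * (a - b) + (A - B) ≡ (v * a + A) - (v * b + B)
  lemma = solve-∀

sumℤ-map-cong : ∀ {f g : Word → ℤ} {L} → All (λ w → f w ≡ g w) L →
                sumℤ (map f L) ≡ sumℤ (map g L)
sumℤ-map-cong [] = refl
sumℤ-map-cong (eq ∷ eqs) = cong₂ _+_ eq (sumℤ-map-cong eqs)

sumℤ-map-coeff : ∀ S L → sumℤ (map (coeff S) L) ≡ weigh (λ s → count s L) S
sumℤ-map-coeff S [] = sym (weigh-zero (All.universal (λ _ → refl) S))
sumℤ-map-coeff S (w ∷ L) =
  trans (cong (_+_ (coeff S w)) (sumℤ-map-coeff S L)) (sym (weigh-+ _ _ S))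

Above : Word → Word → Set
Above x s = isDyck s ≡ true × (x ⊑ᵇ s) ≡ true

coeff-outside : ∀ {x z S} → OnSupport (Above x) S → (x ⊑ᵇ z) ≡ false → coeff S z ≡ 0ℤ
coeff-outside {x} {z} above x⋢z = weigh-zero (All.map vanishes above)
  where
  vanishes : ∀ {s} → Above x s → 𝟙 (s ==ʷ z) ≡ 0ℤ
  vanishes {s} (_ , x⊑s) with s ==ʷ z in s=z
  ... | false = refl
  ... | true rewrite ==ʷ-sound {s} {z} s=z = contradiction (trans (sym x⊑s) x⋢z) λ ()

module WeightedMöbius
  (x top : Word) (S : Weighted) (above : OnSupport (Above x) S) (coeff-x : coeff S x ≡ 1ℤ)
  (mass-vanishes : ∀ {z} → z ⊆ top → isDyck z ≡ true → (x ⊑ᵇ z) ≡ true → z ≢ x →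
                   mass (_⊑ᵇ z) S ≡ 0ℤ)
  where

  μF≡coeff : ∀ n {z} → z ⊆ top → isDyck z ≡ true → length z ≤ n → μF n x z ≡ coeff S z
  μF≡coeff zero {[]} _ () _
  μF≡coeff zero {_ ∷ _} _ _ ()
  μF≡coeff (suc n) {z} z⊆top dyck len with x ==ʷ z in x=z
  ... | true rewrite sym (==ʷ-sound {x} {z} x=z) = sym coeff-x
  ... | false with x ⊑ᵇ z in x⊑z
  ...   | false = sym (coeff-outside {x} above x⊑z)
  ...   | true = begin
    - sumℤ (map (μF n x) (halfOpen x z))        ≡⟨ cong -_ (sumℤ-map-cong (All.map ih below)) ⟩
    - sumℤ (map (coeff S) (halfOpen x z))       ≡⟨ cong -_ (sumℤ-map-coeff S (halfOpen x z)) ⟩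
    - weigh (λ s → count s (halfOpen x z)) S    ≡⟨ cong -_ (weigh-cong (All.map counted above)) ⟩
    - weigh (λ s → 𝟙 (s ⊑ᵇ z) - 𝟙 (s ==ʷ z)) S ≡⟨ cong -_ (weigh-- _ _ S) ⟩
    - (mass (_⊑ᵇ z) S - coeff S z)              ≡⟨ cong (λ m → - (m - coeff S z)) vanishes ⟩
    - (0ℤ - coeff S z)                           ≡⟨ cong -_ (ℤ.+-identityˡ _) ⟩
    - - coeff S z                                ≡⟨ ℤ.neg-involutive _ ⟩
    coeff S z                                    ∎
    where
    open ≡-Reasoning
    below : All (λ w → w ⊆ z × isDyck w ≡ true × w ≢ z) (halfOpen x z)
    below = halfOpen-below x z
    ih : ∀ {w} → w ⊆ z × isDyck w ≡ true × w ≢ z → μF n x w ≡ coeff S w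
    ih (w⊆z , dyck-w , w≢z) =
      μF≡coeff n (⊆-trans w⊆z z⊆top) dyck-w (≤-pred (≤-trans (⊂⇒length< w⊆z w≢z) len))
    counted : ∀ {s} → Above x s → count s (halfOpen x z) ≡ 𝟙 (s ⊑ᵇ z) - 𝟙 (s ==ʷ z)
    counted (dyck-s , x⊑s) = count-halfOpen x z dyck-s x⊑s
    vanishes : mass (_⊑ᵇ z) S ≡ 0ℤ
    vanishes = mass-vanishes z⊆top dyck x⊑z (==ʷ-false⇒≢ x=z ∘ sym)

  μ≡coeff : ∀ {z} → z ⊆ top → isDyck z ≡ true → μ x z ≡ coeff S z
  μ≡coeff z⊆top dyck = μF≡coeff _ z⊆top dyck ≤-refl

-- Block words U^i D^j U^k D^l

blockWord : ℕ → ℕ → ℕ → ℕ → Word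
blockWord i j k l = replicate i U ++ replicate j D ++ replicate k U ++ replicate l D

peak : ℕ → Word
peak n = replicate n U ++ replicate n D

twoPeak : ℕ → ℕ → ℕ → Word
twoPeak p q r = blockWord (p +ℕ q) p r (r +ℕ q)

replicate-++ : ∀ m n (c : Step) → replicate m c ++ replicate n c ≡ replicate (m +ℕ n) c
replicate-++ zero n c = refl
replicate-++ (suc m) n c = cong (c ∷_) (replicate-++ m n c)

replicate-++⁺ : ∀ {i I} (c : Step) {xs ys} → i ≤ I → xs ⊆ ys →
                replicate i c ++ xs ⊆ replicate I c ++ ys
replicate-++⁺ {zero} {zero} c _ xs⊆ys = xs⊆ys
replicate-++⁺ {zero} {suc I} c _ xs⊆ys = c ∷ʳ replicate-++⁺ {zero} {I} c z≤n xs⊆ys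
replicate-++⁺ {suc i} {suc I} c (s≤s i≤I) xs⊆ys = refl ∷ replicate-++⁺ c i≤I xs⊆ys

replicate-++⁻ : ∀ I (c : Step) {z ys} → z ⊆ replicate I c ++ ys →
                ∃[ i ] i ≤ I × ∃[ z′ ] z′ ⊆ ys × z ≡ replicate i c ++ z′
replicate-++⁻ zero c z⊆ys = 0 , z≤n , _ , z⊆ys , refl
replicate-++⁻ (suc I) c (_ ∷ʳ z⊆) with replicate-++⁻ I c z⊆
... | i , i≤I , z′ , z′⊆ys , eq = i , m≤n⇒m≤1+n i≤I , z′ , z′⊆ys , eq
replicate-++⁻ (suc I) c (refl ∷ z⊆) with replicate-++⁻ I c z⊆
... | i , i≤I , z′ , z′⊆ys , refl = suc i , s≤s i≤I , z′ , z′⊆ys , refl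

replicate⁺ : ∀ {m n} (c : Step) → m ≤ n → replicate m c ⊆ replicate n c
replicate⁺ c m≤n =
  subst₂ _⊆_ (++-identityʳ _) (++-identityʳ _) (replicate-++⁺ c m≤n (⊆-refl {x = []}))

replicate-++-injective : ∀ {c : Step} i I {u v} → head u ≢ just c → head v ≢ just c →
                         replicate i c ++ u ≡ replicate I c ++ v → i ≡ I × u ≡ v
replicate-++-injective zero zero _ _ eq = refl , eq
replicate-++-injective zero (suc I) hu _ eq = contradiction (cong head eq) hu
replicate-++-injective (suc i) zero _ hv eq = contradiction (cong head (sym eq)) hv
replicate-++-injective (suc i) (suc I) hu hv eq
  with replicate-++-injective i I hu hv (∷-injectiveʳ eq)
... | refl , u≡v = refl , u≡v

head-D^ : ∀ n → head (replicate n D) ≢ just U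
head-D^ zero ()
head-D^ (suc n) ()

blockWord-mono : ∀ {i j k l I J K L} → i ≤ I → j ≤ J → k ≤ K → l ≤ L →
                 blockWord i j k l ⊆ blockWord I J K L
blockWord-mono i≤I j≤J k≤K l≤L =
  replicate-++⁺ U i≤I (replicate-++⁺ D j≤J (replicate-++⁺ U k≤K (replicate⁺ D l≤L)))

data SubBlockWord (I J K L : ℕ) (z : Word) : Set where
  subBlockWord : ∀ {i j k l} → i ≤ I → j ≤ J → k ≤ K → l ≤ L → z ≡ blockWord i j k l →
                 SubBlockWord I J K L z

⊆-blockWord⁻ : ∀ I J K L {z} → z ⊆ blockWord I J K L → SubBlockWord I J K L z
⊆-blockWord⁻ I J K L z⊆
  with replicate-++⁻ I U z⊆
... | i , i≤I , _ , z⊆ , refl with replicate-++⁻ J D z⊆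
... | j , j≤J , _ , z⊆ , refl with replicate-++⁻ K U z⊆
... | k , k≤K , z₃ , z⊆ , refl
  with replicate-++⁻ L D (subst (z₃ ⊆_) (sym (++-identityʳ (replicate L D))) z⊆)
... | l , l≤L , z′ , z′⊆[] , refl with z′⊆[]
... | [] rewrite ++-identityʳ (replicate l D) = subBlockWord i≤I j≤J k≤K l≤L refl

blockWord-injective : ∀ {i j k l I J K L} →
                      blockWord i (suc j) (suc k) l ≡ blockWord I (suc J) (suc K) L →
                      i ≡ I × j ≡ J × k ≡ K × l ≡ L
blockWord-injective {i} {j} {k} {l} {I} {J} {K} {L} eq
  with replicate-++-injective i I (λ ()) (λ ()) eq
... | refl , eq with replicate-++-injective (suc j) (suc J) (λ ()) (λ ()) eq
... | refl , eq with replicate-++-injective (suc k) (suc K) (head-D^ l) (head-D^ L) eq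
... | refl , eq =
  refl , refl , refl , trans (sym (length-replicate l)) (trans (cong length eq) (length-replicate L))

peak-mono : ∀ {m n} → m ≤ n → peak m ⊆ peak n
peak-mono m≤n = ++⁺ (replicate⁺ U m≤n) (replicate⁺ D m≤n)

twoPeak-mono : ∀ {p q r} P H R → p +ℕ q ≤ P +ℕ H → p ≤ P → r ≤ R → r +ℕ q ≤ R +ℕ H →
               twoPeak p q r ⊆ twoPeak P H R
twoPeak-mono P H R = blockWord-mono

DU : Word
DU = D ∷ U ∷ []

U⊈D^ : ∀ n → ¬ (U ∷ [] ⊆ replicate n D)
U⊈D^ (suc n) (_ ∷ʳ U⊆) = U⊈D^ n U⊆

DU⊈U^++D^ : ∀ m n → ¬ (DU ⊆ replicate m U ++ replicate n D)
DU⊈U^++D^ (suc m) n (_ ∷ʳ DU⊆) = DU⊈U^++D^ m n DU⊆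
DU⊈U^++D^ zero (suc n) (_ ∷ʳ DU⊆) = DU⊈U^++D^ zero n DU⊆
DU⊈U^++D^ zero (suc n) (refl ∷ U⊆) = U⊈D^ n U⊆

DU⊆blockWord⁻ : ∀ i j k l → DU ⊆ blockWord i j k l → 1 ≤ j × 1 ≤ k
DU⊆blockWord⁻ i zero k l DU⊆ =
  contradiction (subst (DU ⊆_) ascents DU⊆) (DU⊈U^++D^ (i +ℕ k) l)
  where
  ascents : blockWord i 0 k l ≡ replicate (i +ℕ k) U ++ replicate l D
  ascents = trans (sym (++-assoc (replicate i U) _ _)) (cong (_++ replicate l D) (replicate-++ i k U))
DU⊆blockWord⁻ i (suc j) zero l DU⊆ =
  contradiction (subst (DU ⊆_) descents DU⊆) (DU⊈U^++D^ i (suc j +ℕ l))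
  where
  descents : blockWord i (suc j) 0 l ≡ replicate i U ++ replicate (suc j +ℕ l) D
  descents = cong (replicate i U ++_) (replicate-++ (suc j) l D)
DU⊆blockWord⁻ i (suc j) (suc k) l _ = z<s , z<s

DU⊆twoPeak : ∀ {p q r} → 1 ≤ p → 1 ≤ r → DU ⊆ twoPeak p q r
DU⊆twoPeak {p} {q} {r} 1≤p 1≤r = blockWord-mono {I = p +ℕ q} {L = r +ℕ q} z≤n 1≤p 1≤r z≤n

twoPeak⊈peak : ∀ {p q r} n → 1 ≤ p → 1 ≤ r → ¬ (twoPeak p q r ⊆ peak n)
twoPeak⊈peak n 1≤p 1≤r sub = DU⊈U^++D^ n n (⊆-trans (DU⊆twoPeak 1≤p 1≤r) sub)

twoPeak≢peak : ∀ {p q r} n → 1 ≤ p → 1 ≤ r → twoPeak p q r ≢ peak n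
twoPeak≢peak n 1≤p 1≤r eq = twoPeak⊈peak n 1≤p 1≤r (⊆-reflexive eq)

UD⊆twoPeak : ∀ {P} H R → 1 ≤ P → UD ⊆ twoPeak P H R
UD⊆twoPeak {P} H R 1≤P = twoPeak-mono P H R (≤-trans 1≤P (m≤m+n P H)) 1≤P z≤n z≤n

-- Dyck subwords of a block word

dyckFrom-U^ : ∀ i h w → dyckFrom h (replicate i U ++ w) ≡ dyckFrom (i +ℕ h) w
dyckFrom-U^ zero h w = refl
dyckFrom-U^ (suc i) h w = trans (dyckFrom-U^ i (suc h) w) (cong (λ n → dyckFrom n w) (+-suc i h))

dyckFrom-D^ : ∀ j h w → dyckFrom (j +ℕ h) (replicate j D ++ w) ≡ dyckFrom h w
dyckFrom-D^ zero h w = refl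
dyckFrom-D^ (suc j) h w = dyckFrom-D^ j h w

dyckFrom-D^⁻ : ∀ j h w → dyckFrom h (replicate j D ++ w) ≡ true →
               j ≤ h × dyckFrom (h ∸ j) w ≡ true
dyckFrom-D^⁻ zero h w ok = z≤n , ok
dyckFrom-D^⁻ (suc j) (suc h) w ok with dyckFrom-D^⁻ j h w ok
... | j≤h , ok′ = s≤s j≤h , ok′

dyckFrom-D^-closes : ∀ h → dyckFrom h (replicate h D) ≡ true
dyckFrom-D^-closes zero = refl
dyckFrom-D^-closes (suc h) = dyckFrom-D^-closes h

dyckFrom-D^-closes⁻ : ∀ l h → dyckFrom h (replicate l D) ≡ true → l ≡ h
dyckFrom-D^-closes⁻ zero zero _ = refl
dyckFrom-D^-closes⁻ (suc l) (suc h) ok = cong suc (dyckFrom-D^-closes⁻ l h ok)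

isDyck-twoPeak : ∀ p q r → isDyck (twoPeak (suc p) q r) ≡ true
isDyck-twoPeak p q r = begin
  dyckFrom 0 (twoPeak (suc p) q r)               ≡⟨ dyckFrom-U^ (suc p +ℕ q) 0 (descent ++ rest) ⟩
  dyckFrom (suc p +ℕ q +ℕ 0) (descent ++ rest)    ≡⟨ cong (λ n → dyckFrom n (descent ++ rest))
                                                         (+-identityʳ (suc p +ℕ q)) ⟩
  dyckFrom (suc p +ℕ q) (descent ++ rest)         ≡⟨ dyckFrom-D^ (suc p) q rest ⟩
  dyckFrom q rest                                ≡⟨ dyckFrom-U^ r q (replicate (r +ℕ q) D) ⟩
  dyckFrom (r +ℕ q) (replicate (r +ℕ q) D)        ≡⟨ dyckFrom-D^-closes (r +ℕ q) ⟩
  true                                           ∎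
  where
  open ≡-Reasoning
  descent rest : Word
  descent = replicate (suc p) D
  rest = replicate r U ++ replicate (r +ℕ q) D

dyckFrom-blockWord⁻ : ∀ i j k l → dyckFrom 0 (blockWord i j k l) ≡ true →
                      j ≤ i × l ≡ k +ℕ (i ∸ j)
dyckFrom-blockWord⁻ i j k l ok
  rewrite dyckFrom-U^ i 0 (replicate j D ++ replicate k U ++ replicate l D) | +-identityʳ i
  with dyckFrom-D^⁻ j i _ ok
... | j≤i , ok′ rewrite dyckFrom-U^ k (i ∸ j) (replicate l D) =
  j≤i , dyckFrom-D^-closes⁻ l (k +ℕ (i ∸ j)) ok′

isDyck⇒dyckFrom : ∀ {w} → isDyck w ≡ true → dyckFrom 0 w ≡ true
isDyck⇒dyckFrom {_ ∷ _} ok = ok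

data DyckShape (J : ℕ) : Word → Set where
  peakShape : ∀ {n} → 1 ≤ n → DyckShape J (peak n)
  twoPeakShape : ∀ {P H R} → 1 ≤ P → 1 ≤ R → P ≤ J → DyckShape J (twoPeak P H R)

ascents++descent : ∀ i k → blockWord i 0 k (k +ℕ i) ≡ peak (i +ℕ k)
ascents++descent i k = trans (sym (++-assoc (replicate i U) _ _))
  (cong₂ _++_ (replicate-++ i k U) (cong (λ n → replicate n D) (+-comm k i)))

dyckShape-blockWord : ∀ {J} i j k → j ≤ i → j ≤ J →
                      isDyck (blockWord i j k (k +ℕ (i ∸ j))) ≡ true → DyckShape J (blockWord i j k (k +ℕ (i ∸ j)))
dyckShape-blockWord zero zero zero _ _ ()
dyckShape-blockWord (suc i) zero k _ _ _ =
  subst (DyckShape _) (sym (ascents++descent (suc i) k)) (peakShape z<s)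
dyckShape-blockWord zero zero (suc k) _ _ _ =
  subst (DyckShape _) (sym (ascents++descent 0 (suc k))) (peakShape z<s)
dyckShape-blockWord {J} i (suc j) zero j≤i _ _ =
  subst (DyckShape J) (sym ascent++descents) (peakShape (≤-trans z<s j≤i))
  where
  ascent++descents : blockWord i (suc j) 0 (i ∸ suc j) ≡ peak i
  ascent++descents = cong (replicate i U ++_)
    (trans (replicate-++ (suc j) (i ∸ suc j) D) (cong (λ n → replicate n D) (m+[n∸m]≡n j≤i)))
dyckShape-blockWord {J} i (suc j) (suc k) j≤i j≤J _ =
  subst (DyckShape J) (cong (λ n → blockWord n (suc j) (suc k) (suc k +ℕ (i ∸ suc j)))
                            (m+[n∸m]≡n j≤i))
        (twoPeakShape z<s z<s j≤J)

dyckShape : ∀ I J K L {z} → z ⊆ blockWord I J K L → isDyck z ≡ true → DyckShape J z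
dyckShape I J K L sub ok with ⊆-blockWord⁻ I J K L sub
... | subBlockWord {i} {j} {k} {l} _ j≤J _ _ refl
  with dyckFrom-blockWord⁻ i j k l (isDyck⇒dyckFrom {blockWord i j k l} ok)
... | j≤i , refl = dyckShape-blockWord i j k j≤i j≤J ok

-- Subword order on two-peak words

twoPeak-⊆⁻ : ∀ p q r P H R → 1 ≤ p → 1 ≤ r → twoPeak p q r ⊆ twoPeak P H R →
             p +ℕ q ≤ P +ℕ H × p ≤ P × r ≤ R × r +ℕ q ≤ R +ℕ H
twoPeak-⊆⁻ (suc p) q (suc r) P H R 1≤p 1≤r sub
  with ⊆-blockWord⁻ (P +ℕ H) P R (R +ℕ H) sub
... | subBlockWord {i} {j₀} {k₀} {l} i≤ j≤ k≤ l≤ eq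
  with DU⊆blockWord⁻ i j₀ k₀ l (subst (DU ⊆_) eq (DU⊆twoPeak 1≤p 1≤r))
... | s≤s {n = j} z≤n , s≤s {n = k} z≤n
  with blockWord-injective {suc p +ℕ q} {p} {r} {suc r +ℕ q} {i} {j} {k} {l} eq
... | refl , refl , refl , refl = i≤ , j≤ , k≤ , l≤

twoPeak-raise : ∀ {p r} P H R → 1 ≤ p → 1 ≤ r → 1 ≤ H →
                twoPeak p 0 r ⊆ twoPeak P H R → twoPeak p 1 r ⊆ twoPeak P H R
twoPeak-raise {p} {r} P H R 1≤p 1≤r 1≤H sub with twoPeak-⊆⁻ p 0 r P H R 1≤p 1≤r sub
... | _ , p≤P , r≤R , _ = twoPeak-mono P H R (+-mono-≤ p≤P 1≤H) p≤P r≤R (+-mono-≤ r≤R 1≤H)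

⊑ᵇ-raise : ∀ p r P H R → 1 ≤ p → 1 ≤ r → 1 ≤ H →
           (twoPeak p 1 r ⊑ᵇ twoPeak P H R) ≡ (twoPeak p 0 r ⊑ᵇ twoPeak P H R)
⊑ᵇ-raise p r P H R 1≤p 1≤r 1≤H = ⇔→≡ {z = true} (mk⇔
  (λ ok → ⊑ᵇ-complete (⊆-trans lower (⊑ᵇ-sound ok)))
  (λ ok → ⊑ᵇ-complete (twoPeak-raise P H R 1≤p 1≤r 1≤H (⊑ᵇ-sound ok))))
  where
  lower : twoPeak p 0 r ⊆ twoPeak p 1 r
  lower = twoPeak-mono p 1 r (+-monoʳ-≤ p z≤n) ≤-refl ≤-refl (+-monoʳ-≤ r z≤n)

⊑ᵇ-flat : ∀ p q r P R → 1 ≤ p → 1 ≤ r →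
          (twoPeak p q r ⊑ᵇ twoPeak P 0 R) ≡ (q +ℕ p ≤ᵇ P) ∧ (q +ℕ r ≤ᵇ R)
⊑ᵇ-flat p q r P R 1≤p 1≤r = ⇔→≡ {z = true} (mk⇔ to from)
  where
  to : (twoPeak p q r ⊑ᵇ twoPeak P 0 R) ≡ true → (q +ℕ p ≤ᵇ P) ∧ (q +ℕ r ≤ᵇ R) ≡ true
  to ok with twoPeak-⊆⁻ p q r P 0 R 1≤p 1≤r (⊑ᵇ-sound ok)
  ... | p+q≤ , _ , _ , r+q≤ =
    cong₂ _∧_ (≤ᵇ-true (subst₂ _≤_ (+-comm p q) (+-identityʳ P) p+q≤))
              (≤ᵇ-true (subst₂ _≤_ (+-comm r q) (+-identityʳ R) r+q≤))
  from : (q +ℕ p ≤ᵇ P) ∧ (q +ℕ r ≤ᵇ R) ≡ true → (twoPeak p q r ⊑ᵇ twoPeak P 0 R) ≡ true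
  from ok with ∧-true⁻ ok
  ... | q+p≤ , q+r≤ = ⊑ᵇ-complete (twoPeak-mono P 0 R
    (subst₂ _≤_ (+-comm q p) (sym (+-identityʳ P)) (≤ᵇ-true⁻ q+p≤))
    (≤-trans (m≤n+m p q) (≤ᵇ-true⁻ q+p≤))
    (≤-trans (m≤n+m r q) (≤ᵇ-true⁻ q+r≤))
    (subst₂ _≤_ (+-comm q r) (sym (+-identityʳ R)) (≤ᵇ-true⁻ q+r≤)))

-- The values of μ(UD, -) below Q

levelMass : (Word → Bool) → ℕ → ℕ → ℤ
levelMass p q k =
  𝟙 (p (twoPeak k q (suc k))) + 𝟙 (p (twoPeak (suc k) q k)) - + 2 * 𝟙 (p (twoPeak k q k))

block : ℕ → Weighted
block k = (twoPeak k 0 (suc k) , 1ℤ) ∷ (twoPeak (suc k) 0 k , 1ℤ) ∷ (twoPeak k 0 k , - + 2)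
        ∷ (twoPeak k 1 (suc k) , -1ℤ) ∷ (twoPeak (suc k) 1 k , -1ℤ) ∷ (twoPeak k 1 k , + 2) ∷ []

blocks : ℕ → Weighted
blocks zero = []
blocks (suc N) = blocks N ++ block (suc N)

-- The first two terms correct the block weights at k = 1: μ(UD, UDUD) = −1, μ(UD, UUDUDD) = 1.
twoPeakPart : ℕ → Weighted
twoPeakPart N = (twoPeak 1 0 1 , 1ℤ) ∷ (twoPeak 1 1 1 , -1ℤ) ∷ blocks N

mobiusUD : ℕ → Weighted
mobiusUD N = (peak 1 , 1ℤ) ∷ (peak 2 , -1ℤ) ∷ twoPeakPart N

mass-block : ∀ p k → mass p (block k) ≡ levelMass p 0 k - levelMass p 1 k
mass-block p k = lemma
  (𝟙 (p (twoPeak k 0 (suc k)))) (𝟙 (p (twoPeak (suc k) 0 k))) (𝟙 (p (twoPeak k 0 k)))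
  (𝟙 (p (twoPeak k 1 (suc k)))) (𝟙 (p (twoPeak (suc k) 1 k))) (𝟙 (p (twoPeak k 1 k)))
  where
  lemma : ∀ a b c a′ b′ c′ →
          1ℤ * a + (1ℤ * b + (- + 2 * c + (-1ℤ * a′ + (-1ℤ * b′ + (+ 2 * c′ + 0ℤ)))))
          ≡ (a + b - + 2 * c) - (a′ + b′ - + 2 * c′)
  lemma = solve-∀

mass-blocks : ∀ p (g : ℕ → ℤ) → (∀ k → mass p (block (suc k)) ≡ g (suc k) - g (suc (suc k))) →
              ∀ N → mass p (blocks N) ≡ g 1 - g (suc N)
mass-blocks p g step zero = sym (ℤ.+-inverseʳ (g 1))
mass-blocks p g step (suc N) = begin
  mass p (blocks N ++ block (suc N))                 ≡⟨ weigh-++ _ (blocks N) (block (suc N)) ⟩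
  mass p (blocks N) + mass p (block (suc N))         ≡⟨ cong₂ _+_ (mass-blocks p g step N) (step N) ⟩
  (g 1 - g (suc N)) + (g (suc N) - g (suc (suc N)))  ≡⟨ lemma (g 1) (g (suc N)) (g (suc (suc N))) ⟩
  g 1 - g (suc (suc N))                              ∎
  where
  open ≡-Reasoning
  lemma : ∀ x y z → (x - y) + (y - z) ≡ x - z
  lemma = solve-∀

mass-mobiusUD : ∀ p N → mass p (mobiusUD N) ≡
  𝟙 (p (peak 1)) - 𝟙 (p (peak 2)) + (𝟙 (p (twoPeak 1 0 1)) - 𝟙 (p (twoPeak 1 1 1)))
  + mass p (blocks N)
mass-mobiusUD p N = lemma
  (𝟙 (p (peak 1))) (𝟙 (p (peak 2))) (𝟙 (p (twoPeak 1 0 1))) (𝟙 (p (twoPeak 1 1 1)))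
  (mass p (blocks N))
  where
  lemma : ∀ a b c d m → 1ℤ * a + (-1ℤ * b + (1ℤ * c + (-1ℤ * d + m))) ≡ a - b + (c - d) + m
  lemma = solve-∀

data Balanced : Word → Set where
  balanced : ∀ {p q r} → 1 ≤ p → 1 ≤ r → q ≤ 1 → r ≤ suc p → p ≤ suc r →
             Balanced (twoPeak p q r)

twoPeakPart-balanced : ∀ N → OnSupport Balanced (twoPeakPart N)
twoPeakPart-balanced N =
  balanced z<s z<s z≤n z<s z<s ∷ balanced z<s z<s ≤-refl z<s z<s ∷ blocks-balanced N
  where
  blocks-balanced : ∀ N → OnSupport Balanced (blocks N)
  blocks-balanced zero = []
  blocks-balanced (suc N) = Allₚ.++⁺ (blocks-balanced N)
    ( balanced z<s z<s z≤n ≤-refl k≤k+2 ∷ balanced z<s z<s z≤n k≤k+2 ≤-refl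
    ∷ balanced z<s z<s z≤n (n≤1+n _) (n≤1+n _)
    ∷ balanced z<s z<s ≤-refl ≤-refl k≤k+2 ∷ balanced z<s z<s ≤-refl k≤k+2 ≤-refl
    ∷ balanced z<s z<s ≤-refl (n≤1+n _) (n≤1+n _) ∷ [])
    where
    k≤k+2 : suc N ≤ suc (suc (suc N))
    k≤k+2 = ≤-trans (n≤1+n _) (n≤1+n _)

balanced-above : ∀ {s} → Balanced s → Above UD s
balanced-above (balanced {suc p} {q} {r} 1≤p _ _ _ _) =
  isDyck-twoPeak p q r , ⊑ᵇ-complete (UD⊆twoPeak q r 1≤p)

balanced⋢peak : ∀ {s} n → Balanced s → (s ⊑ᵇ peak n) ≡ false
balanced⋢peak n (balanced 1≤p 1≤r _ _ _) = ⊑ᵇ-false (twoPeak⊈peak n 1≤p 1≤r)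

balanced≢peak : ∀ {s} n → Balanced s → s ≢ peak n
balanced≢peak n (balanced 1≤p 1≤r _ _ _) = twoPeak≢peak n 1≤p 1≤r

balanced≢unbalanced : ∀ {a h b s} → 1 ≤ a → 1 ≤ b → 2 ≤ h ⊎ 2 ≤ b ∸ a → Balanced s →
                      s ≢ twoPeak a h b
balanced≢unbalanced {a} {h} {b} 1≤a 1≤b unbalanced (balanced {p} {q} {r} 1≤p 1≤r q≤1 r≤1+p _) eq
  with twoPeak-⊆⁻ a h b p q r 1≤a 1≤b (⊆-reflexive (sym eq))
     | twoPeak-⊆⁻ p q r a h b 1≤p 1≤r (⊆-reflexive eq)
... | a+h≤p+q , _ , b≤r , _ | _ , p≤a , _ , _ = [ flip <⇒≱ h≤1 , flip <⇒≱ b∸a≤1 ] unbalanced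
  where
  h≤1 : h ≤ 1
  h≤1 = ≤-trans (+-cancelˡ-≤ a h q (≤-trans a+h≤p+q (+-monoˡ-≤ q p≤a))) q≤1
  b∸a≤1 : b ∸ a ≤ 1
  b∸a≤1 = subst (b ∸ a ≤_) (m+n∸n≡m 1 a)
                (∸-monoˡ-≤ a (≤-trans b≤r (≤-trans r≤1+p (s≤s p≤a))))

mobiusUD-above : ∀ N → OnSupport (Above UD) (mobiusUD N)
mobiusUD-above N = (refl , refl) ∷ (refl , refl) ∷ All.map balanced-above (twoPeakPart-balanced N)

coeff-mobiusUD-UD : ∀ N → coeff (mobiusUD N) UD ≡ 1ℤ
coeff-mobiusUD-UD N = cong (λ m → 1ℤ * 1ℤ + (-1ℤ * 0ℤ + m))
  (weigh-zero (All.map (cong 𝟙 ∘ ==ʷ-false ∘ balanced≢peak 1) (twoPeakPart-balanced N)))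

coeff-mobiusUD-unbalanced : ∀ N {a h b} → 1 ≤ a → 1 ≤ b → 2 ≤ h ⊎ 2 ≤ b ∸ a →
                            coeff (mobiusUD N) (twoPeak a h b) ≡ 0ℤ
coeff-mobiusUD-unbalanced N {a} {h} {b} 1≤a 1≤b unbalanced = weigh-zero {S = mobiusUD N}
  ( peak≢ 1 ∷ peak≢ 2
  ∷ All.map (cong 𝟙 ∘ ==ʷ-false ∘ balanced≢unbalanced 1≤a 1≤b unbalanced) (twoPeakPart-balanced N))
  where
  peak≢ : ∀ n → 𝟙 (peak n ==ʷ twoPeak a h b) ≡ 0ℤ
  peak≢ n = cong 𝟙 (==ʷ-false (twoPeak≢peak n 1≤a 1≤b ∘ sym))

mass-mobiusUD-peak : ∀ N {n} → 2 ≤ n → mass (_⊑ᵇ peak n) (mobiusUD N) ≡ 0ℤ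
mass-mobiusUD-peak N {n} 2≤n
  rewrite ⊑ᵇ-complete (peak-mono {1} {n} (≤-trans z<s 2≤n)) | ⊑ᵇ-complete (peak-mono {2} 2≤n)
        | weigh-zero {S = twoPeakPart N}
            (All.map (cong 𝟙 ∘ balanced⋢peak n) (twoPeakPart-balanced N)) = refl

twoPeak101⊆twoPeak : ∀ {P R} H → 1 ≤ P → 1 ≤ R → twoPeak 1 0 1 ⊆ twoPeak P H R
twoPeak101⊆twoPeak {P} {R} H 1≤P 1≤R =
  twoPeak-mono P H R (≤-trans 1≤P (m≤m+n P H)) 1≤P 1≤R (≤-trans 1≤R (m≤m+n R H))

peak2⊆twoPeak : ∀ {P H} R → 1 ≤ P → 1 ≤ R → 1 ≤ H → peak 2 ⊆ twoPeak P H R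
peak2⊆twoPeak {P} {H} R 1≤P 1≤R 1≤H =
  blockWord-mono {I = P +ℕ H} {L = R +ℕ H} (+-mono-≤ 1≤P 1≤H) 1≤P z≤n (≤-trans 1≤R (m≤m+n R H))

mass-block-raised : ∀ P H R → 1 ≤ H → ∀ k → mass (_⊑ᵇ twoPeak P H R) (block (suc k)) ≡ 0ℤ
mass-block-raised P H R 1≤H k
  rewrite mass-block (_⊑ᵇ twoPeak P H R) (suc k)
        | ⊑ᵇ-raise (suc k) (suc (suc k)) P H R z<s z<s 1≤H
        | ⊑ᵇ-raise (suc (suc k)) (suc k) P H R z<s z<s 1≤H
        | ⊑ᵇ-raise (suc k) (suc k) P H R z<s z<s 1≤H =
  ℤ.+-inverseʳ (levelMass (_⊑ᵇ twoPeak P H R) 0 (suc k))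

mass-mobiusUD-raised : ∀ N {P H R} → 1 ≤ P → 1 ≤ R → 1 ≤ H →
                       mass (_⊑ᵇ twoPeak P H R) (mobiusUD N) ≡ 0ℤ
mass-mobiusUD-raised N {P} {H} {R} 1≤P 1≤R 1≤H
  rewrite mass-mobiusUD (_⊑ᵇ twoPeak P H R) N
        | ⊑ᵇ-complete (UD⊆twoPeak H R 1≤P) | ⊑ᵇ-complete (peak2⊆twoPeak R 1≤P 1≤R 1≤H)
        | ⊑ᵇ-raise 1 1 P H R z<s z<s 1≤H | ⊑ᵇ-complete (twoPeak101⊆twoPeak H 1≤P 1≤R)
        | mass-blocks (_⊑ᵇ twoPeak P H R) (λ _ → 0ℤ) (mass-block-raised P H R 1≤H) N = refl

-- Below a two-peak word with q = 0, raising q by one has the same effect as widening both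
-- peaks by one, so the level masses of consecutive blocks cancel.
levelMass-flat : ∀ P R k → levelMass (_⊑ᵇ twoPeak P 0 R) 1 (suc k) ≡
                           levelMass (_⊑ᵇ twoPeak P 0 R) 0 (suc (suc k))
levelMass-flat P R k
  rewrite ⊑ᵇ-flat (suc k) 1 (suc (suc k)) P R z<s z<s
        | ⊑ᵇ-flat (suc (suc k)) 1 (suc k) P R z<s z<s
        | ⊑ᵇ-flat (suc k) 1 (suc k) P R z<s z<s
        | ⊑ᵇ-flat (suc (suc k)) 0 (suc (suc (suc k))) P R z<s z<s
        | ⊑ᵇ-flat (suc (suc (suc k))) 0 (suc (suc k)) P R z<s z<s
        | ⊑ᵇ-flat (suc (suc k)) 0 (suc (suc k)) P R z<s z<s = refl

mass-block-flat : ∀ P R k → mass (_⊑ᵇ twoPeak P 0 R) (block (suc k)) ≡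
                  levelMass (_⊑ᵇ twoPeak P 0 R) 0 (suc k) - levelMass (_⊑ᵇ twoPeak P 0 R) 0 (suc (suc k))
mass-block-flat P R k = trans (mass-block (_⊑ᵇ twoPeak P 0 R) (suc k))
  (cong (_-_ (levelMass (_⊑ᵇ twoPeak P 0 R) 0 (suc k))) (levelMass-flat P R k))

levelMass-tall : ∀ {P} R N → P ≤ N → levelMass (_⊑ᵇ twoPeak P 0 R) 0 (suc N) ≡ 0ℤ
levelMass-tall {P} R N P≤N
  rewrite ⊑ᵇ-flat (suc N) 0 (suc (suc N)) P R z<s z<s
        | ⊑ᵇ-flat (suc (suc N)) 0 (suc N) P R z<s z<s
        | ⊑ᵇ-flat (suc N) 0 (suc N) P R z<s z<s
        | ≤ᵇ-false {suc N} {P} (s≤s P≤N)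
        | ≤ᵇ-false {suc (suc N)} {P} (s≤s (m≤n⇒m≤1+n P≤N)) = refl

⊑ᵇ-peak2-flat : ∀ P R → 1 ≤ P → 1 ≤ R →
                (peak 2 ⊑ᵇ twoPeak P 0 R) ≡ (2 ≤ᵇ P) ∨ (2 ≤ᵇ R)
⊑ᵇ-peak2-flat 1 1 _ _ = refl
⊑ᵇ-peak2-flat (suc (suc P)) R _ _ =
  ⊑ᵇ-complete (twoPeak-mono (suc (suc P)) 0 R sz<ss sz<ss z≤n z≤n)
⊑ᵇ-peak2-flat 1 (suc (suc R)) _ _ =
  ⊑ᵇ-complete (blockWord-mono {I = 1} {J = 1} {K = suc (suc R)} {L = suc (suc R) +ℕ 0}
                               z≤n z≤n sz<ss sz<ss)

inclusion-exclusion : ∀ x y →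
  𝟙 true - 𝟙 (x ∨ y) + (𝟙 (true ∧ true) - 𝟙 (x ∧ y))
  + (𝟙 (true ∧ y) + 𝟙 (x ∧ true) - + 2 * 𝟙 (true ∧ true) - 0ℤ) ≡ 0ℤ
inclusion-exclusion false false = refl
inclusion-exclusion false true = refl
inclusion-exclusion true false = refl
inclusion-exclusion true true = refl

mass-mobiusUD-flat : ∀ N {P R} → 1 ≤ P → 1 ≤ R → P ≤ N →
                     mass (_⊑ᵇ twoPeak P 0 R) (mobiusUD N) ≡ 0ℤ
mass-mobiusUD-flat N {P@(suc P′)} {R@(suc R′)} 1≤P 1≤R P≤N
  rewrite mass-mobiusUD (_⊑ᵇ twoPeak P 0 R) N
        | mass-blocks (_⊑ᵇ twoPeak P 0 R) (levelMass (_⊑ᵇ twoPeak P 0 R) 0) (mass-block-flat P R) N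
        | levelMass-tall R N P≤N
        | ⊑ᵇ-complete (UD⊆twoPeak 0 R 1≤P) | ⊑ᵇ-peak2-flat P R 1≤P 1≤R
        | ⊑ᵇ-flat 1 0 1 P R z<s z<s | ⊑ᵇ-flat 1 1 1 P R z<s z<s
        | ⊑ᵇ-flat 1 0 2 P R z<s z<s | ⊑ᵇ-flat 2 0 1 P R z<s z<s =
  inclusion-exclusion (1 ≤ᵇ P′) (1 ≤ᵇ R′)

mass-mobiusUD-vanishes : ∀ a b h {z} → z ⊆ twoPeak a h b → isDyck z ≡ true → z ≢ UD →
                         mass (_⊑ᵇ z) (mobiusUD a) ≡ 0ℤ
mass-mobiusUD-vanishes a b h sub dyck z≢UD with dyckShape (a +ℕ h) a b (b +ℕ h) sub dyck
... | peakShape {1} _ = contradiction refl z≢UD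
... | peakShape {suc (suc n)} _ = mass-mobiusUD-peak a {suc (suc n)} sz<ss
... | twoPeakShape {H = zero} 1≤P 1≤R P≤a = mass-mobiusUD-flat a 1≤P 1≤R P≤a
... | twoPeakShape {H = suc H} 1≤P 1≤R _ = mass-mobiusUD-raised a 1≤P 1≤R z<s

mainTheorem10 : (a b h : ℕ) → 1 ≤ a → a ≤ b → (2 ≤ h ⊎ 2 ≤ b ∸ a) →
    μ (U ∷ D ∷ []) (Q a b h) ≡ 0ℤ
mainTheorem10 a@(suc a′) b h 1≤a a≤b unbalanced = begin
  μ UD (Q a b h)                      ≡⟨ μ≡coeff ⊆-refl (isDyck-twoPeak a′ h b) ⟩
  coeff (mobiusUD a) (twoPeak a h b)  ≡⟨ coeff-mobiusUD-unbalanced a 1≤a 1≤b unbalanced ⟩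
  0ℤ                                  ∎
  where
  open ≡-Reasoning
  1≤b : 1 ≤ b
  1≤b = ≤-trans 1≤a a≤b
  open WeightedMöbius UD (Q a b h) (mobiusUD a) (mobiusUD-above a) (coeff-mobiusUD-UD a)
                      (λ sub dyck _ → mass-mobiusUD-vanishes a b h sub dyck)
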